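{- Let $A$ be a positive integer such that $(A,A)$ is a polynomial pair. Then $(A^{*},A^{*})$ is a polynomial pair, and $(A^{2})^{*}=(A^{*})^{2}$.
   Context: For a positive integer $A$ with decimal representation $A=\sum_{i=0}^{a} a_i 10^i$ (digits $a_i\in\{0,\dots,9\}$, $a_a\neq0$), let $P(A,x)=\sum_{i=0}^a a_ix^i$ and let $A^{*}=\sum_{i=0}^a a_i10^{a-i}$ be its reversal (the decimal digits read backwards). A pair $(A,B)$ of positive integers is a polynomial pair if $P(A,x)P(B,x)=P(A\times B,x)$. -}

module Defs where

open import Data.Nat using (ℕ; zero; suc; _+_; _*_; _≡ᵇ_)
open import Data.Nat.DivMod using (_/_; _%_)
open import Data.List using (List; []; _∷_; reverse; foldr)
open import Data.Bool using (if_then_else_)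

-- Little-endian decimal digits a_0, a_1, ..., a_a of a positive integer A
-- (no leading zeros; digitsOf 0 = []).  The first argument is fuel,
-- and A steps of fuel are always enough (each step divides by 10).
digitsAux : ℕ → ℕ → List ℕ
digitsAux zero      _ = []
digitsAux (suc f)   n = if n ≡ᵇ 0 then [] else (n % 10) ∷ digitsAux f (n / 10)

digits : ℕ → List ℕ
digits n = digitsAux n n

fromDigits : List ℕ → ℕ
fromDigits = foldr (λ d acc → d + 10 * acc) 0

rev : ℕ → ℕ
rev A = fromDigits (reverse (digits A))

-- Polynomials with natural coefficients as little-endian coefficient lists.
-- P(A,x) is represented by  digits A  (coefficient of x^i = a_i).
polyAdd : List ℕ → List ℕ → List ℕ
polyAdd []       q        = q
polyAdd p        []       = p
polyAdd (a ∷ p)  (b ∷ q)  = (a + b) ∷ polyAdd p q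

scale : ℕ → List ℕ → List ℕ
scale c []      = []
scale c (a ∷ p) = (c * a) ∷ scale c p

polyMul : List ℕ → List ℕ → List ℕ
polyMul []      q = []
polyMul (a ∷ p) q = polyAdd (scale a q) (0 ∷ polyMul p q)

P : ℕ → List ℕ
P A = digits A

-- (A,B) is a polynomial pair: P(A,x) P(B,x) = P(A*B,x) as polynomials,
-- i.e. equality of coefficient lists.  (Both sides have nonzero leading
-- coefficient for A,B > 0, so list equality is polynomial equality.)
PolyPair : ℕ → ℕ → Set
PolyPair A B = polyMul (P A) (P B) ≡ P (A * B)
  where open import Relation.Binary.PropositionalEquality using (_≡_)

module Submission where

-- Write  digits A = 0^z ++ (h ∷ t)  with h ≠ 0 (z trailing decimal zeros of
-- A, listed low digit first); then  digits A* = reverse (h ∷ t).  Two facts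
-- about coefficient lists drive the proof:
--   * reversal is multiplicative:  reverse (p q) = (reverse p) (reverse q);
--   * low zero coefficients factor out: (0^y ++ p)(0^z ++ q) = 0^y ++ 0^z ++ p q.
-- With evaluation at 10 being a homomorphism and  digits n  being the unique
-- list of entries < 10 with nonzero last entry and value n, we get for every
-- polynomial pair (A,B):  rev (A B) = rev A · rev B  (reverse P(A)P(B) = P(AB)
-- and evaluate), and (A*,B*) is a polynomial pair (the coefficients of
-- P(A*)P(B*) are those of P(AB) reversed, with leading coefficient h_A h_B ≠ 0).

open import Defs
open import Data.Nat using (ℕ; _*_; _>_)
open import Data.Product using (_×_)
open import Relation.Binary.PropositionalEquality using (_≡_)

open import Data.Nat using (zero; suc; _+_; _≤_; _<_; z≤n; s≤s)
open import Data.Nat.Properties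
open import Data.Nat.DivMod
  using (_/_; _%_; m≡m%n+[m/n]*n; m%n<n; m/n<m; [m+kn]%n≡m%n; m<n⇒m%n≡m; m<n⇒m/n≡0; m*n/n≡m; +-distrib-/-∣ʳ)
open import Data.Nat.Divisibility using (n∣m*n)
open import Data.List using (List; []; _∷_; reverse; _++_; length; replicate; map)
open import Data.List.Properties using (reverse-++; length-reverse; reverse-map; length-++; unfold-reverse; length-replicate)
open import Data.List.Relation.Unary.All using (All; []; _∷_)
open import Data.List.Relation.Unary.All.Properties using (++⁺; ++⁻ʳ)
open import Data.Product using (_,_; ∃-syntax)
open import Data.Unit using (⊤)
open import Relation.Nullary using (contradiction)
open import Relation.Binary.PropositionalEquality using (refl; sym; trans; cong; cong₂; subst; subst₂; _≢_; module ≡-Reasoning)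
open import Data.Nat.Solver using (module +-*-Solver)

zeros : ℕ → List ℕ
zeros k = replicate k 0

length-zeros-++ : ∀ k u → length (zeros k ++ u) ≡ k + length u
length-zeros-++ k u = trans (length-++ (zeros k)) (cong (_+ length u) (length-replicate k))

reverse-zeros : ∀ k → reverse (zeros k) ≡ zeros k
reverse-zeros zero    = refl
reverse-zeros (suc k) = begin
    reverse (0 ∷ zeros k)        ≡⟨ unfold-reverse 0 (zeros k) ⟩
    reverse (zeros k) ++ 0 ∷ []  ≡⟨ cong (_++ 0 ∷ []) (reverse-zeros k) ⟩
    zeros k ++ 0 ∷ []            ≡⟨ zeros-snoc k ⟩
    0 ∷ zeros k                  ∎
  where
  open ≡-Reasoning
  zeros-snoc : ∀ k → zeros k ++ 0 ∷ [] ≡ 0 ∷ zeros k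
  zeros-snoc zero    = refl
  zeros-snoc (suc k) = cong (0 ∷_) (zeros-snoc k)

All-reverse : ∀ {A : Set} {Q : A → Set} xs → All Q xs → All Q (reverse xs)
All-reverse []       []         = []
All-reverse {Q = Q} (x ∷ xs) (qx ∷ qxs) =
  subst (All Q) (sym (unfold-reverse x xs)) (++⁺ (All-reverse xs qxs) (qx ∷ []))


polyAdd-identityʳ : ∀ p → polyAdd p [] ≡ p
polyAdd-identityʳ []      = refl
polyAdd-identityʳ (a ∷ p) = refl

polyAdd-comm : ∀ p q → polyAdd p q ≡ polyAdd q p
polyAdd-comm []      q       = sym (polyAdd-identityʳ q)
polyAdd-comm (a ∷ p) []      = refl
polyAdd-comm (a ∷ p) (b ∷ q) = cong₂ _∷_ (+-comm a b) (polyAdd-comm p q)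

polyAdd-assoc : ∀ p q r → polyAdd (polyAdd p q) r ≡ polyAdd p (polyAdd q r)
polyAdd-assoc []      q       r       = refl
polyAdd-assoc (a ∷ p) []      r       = refl
polyAdd-assoc (a ∷ p) (b ∷ q) []      = refl
polyAdd-assoc (a ∷ p) (b ∷ q) (c ∷ r) = cong₂ _∷_ (+-assoc a b c) (polyAdd-assoc p q r)

length-polyAdd : ∀ u v → length u ≤ length v → length (polyAdd u v) ≡ length v
length-polyAdd []      v       _       = refl
length-polyAdd (a ∷ u) (b ∷ v) (s≤s h) = cong suc (length-polyAdd u v h)

polyAdd-zerosʳ : ∀ u k v → length u + k ≤ length v → polyAdd (u ++ zeros k) v ≡ polyAdd u v
polyAdd-zerosʳ []      zero    v       _       = refl
polyAdd-zerosʳ []      (suc k) (b ∷ v) (s≤s h) = cong (b ∷_) (polyAdd-zerosʳ [] k v h)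
polyAdd-zerosʳ (a ∷ u) k       (b ∷ v) (s≤s h) = cong ((a + b) ∷_) (polyAdd-zerosʳ u k v h)

polyAdd-++ : ∀ x x′ y y′ → length x ≡ length y →
  polyAdd (x ++ x′) (y ++ y′) ≡ polyAdd x y ++ polyAdd x′ y′
polyAdd-++ []      x′ []      y′ _  = refl
polyAdd-++ (a ∷ x) x′ (b ∷ y) y′ eq = cong ((a + b) ∷_) (polyAdd-++ x x′ y y′ (suc-injective eq))

reverse-polyAdd : ∀ u v → length u ≡ length v →
  reverse (polyAdd u v) ≡ polyAdd (reverse u) (reverse v)
reverse-polyAdd []      []      _  = refl
reverse-polyAdd (a ∷ u) (b ∷ v) eq = begin
    reverse ((a + b) ∷ polyAdd u v)
  ≡⟨ unfold-reverse (a + b) (polyAdd u v) ⟩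
    reverse (polyAdd u v) ++ (a + b) ∷ []
  ≡⟨ cong (_++ (a + b) ∷ []) (reverse-polyAdd u v (suc-injective eq)) ⟩
    polyAdd (reverse u) (reverse v) ++ polyAdd (a ∷ []) (b ∷ [])
  ≡⟨ sym (polyAdd-++ (reverse u) (a ∷ []) (reverse v) (b ∷ []) reversed-lengths) ⟩
    polyAdd (reverse u ++ a ∷ []) (reverse v ++ b ∷ [])
  ≡⟨ sym (cong₂ polyAdd (unfold-reverse a u) (unfold-reverse b v)) ⟩
    polyAdd (reverse (a ∷ u)) (reverse (b ∷ v))
  ∎
  where
  open ≡-Reasoning
  reversed-lengths : length (reverse u) ≡ length (reverse v)
  reversed-lengths = trans (length-reverse u) (trans (suc-injective eq) (sym (length-reverse v)))

reverse-polyAdd-shorter : ∀ u k v → length u + k ≡ length v →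
  reverse (polyAdd u v) ≡ polyAdd (zeros k ++ reverse u) (reverse v)
reverse-polyAdd-shorter u k v eq = begin
    reverse (polyAdd u v)
  ≡⟨ cong reverse (sym (polyAdd-zerosʳ u k v (≤-reflexive eq))) ⟩
    reverse (polyAdd (u ++ zeros k) v)
  ≡⟨ reverse-polyAdd (u ++ zeros k) v padded-length ⟩
    polyAdd (reverse (u ++ zeros k)) (reverse v)
  ≡⟨ cong (λ w → polyAdd w (reverse v)) (reverse-++ u (zeros k)) ⟩
    polyAdd (reverse (zeros k) ++ reverse u) (reverse v)
  ≡⟨ cong (λ w → polyAdd (w ++ reverse u) (reverse v)) (reverse-zeros k) ⟩
    polyAdd (zeros k ++ reverse u) (reverse v)
  ∎
  where
  open ≡-Reasoning
  padded-length : length (u ++ zeros k) ≡ length v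
  padded-length = trans (length-++ u) (trans (cong (length u +_) (length-replicate k)) eq)


scale-map : ∀ c p → scale c p ≡ map (c *_) p
scale-map c []      = refl
scale-map c (a ∷ p) = cong ((c * a) ∷_) (scale-map c p)

reverse-scale : ∀ c p → reverse (scale c p) ≡ scale c (reverse p)
reverse-scale c p = begin
    reverse (scale c p)      ≡⟨ cong reverse (scale-map c p) ⟩
    reverse (map (c *_) p)   ≡⟨ sym (reverse-map (c *_) p) ⟩
    map (c *_) (reverse p)   ≡⟨ sym (scale-map c (reverse p)) ⟩
    scale c (reverse p)      ∎
  where open ≡-Reasoning

length-scale : ∀ c p → length (scale c p) ≡ length p
length-scale c []      = refl
length-scale c (a ∷ p) = cong suc (length-scale c p)

scale-zero : ∀ p → scale 0 p ≡ zeros (length p)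
scale-zero []      = refl
scale-zero (a ∷ p) = cong (0 ∷_) (scale-zero p)


polyMul-[]ʳ : ∀ p → polyMul p [] ≡ zeros (length p)
polyMul-[]ʳ []      = refl
polyMul-[]ʳ (a ∷ p) = cong (0 ∷_) (polyMul-[]ʳ p)

polyMul-singleton : ∀ a q → 1 ≤ length q → polyMul (a ∷ []) q ≡ scale a q
polyMul-singleton a (b ∷ q) _ = cong₂ _∷_ (+-identityʳ (a * b)) (polyAdd-identityʳ (scale a q))

length-polyMul : ∀ p q → 1 ≤ length p → 1 ≤ length q →
  suc (length (polyMul p q)) ≡ length p + length q
length-polyMul (a ∷ [])     q _ hq =
  cong suc (trans (cong length (polyMul-singleton a q hq)) (length-scale a q))
length-polyMul (a ∷ a′ ∷ p) q _ hq = extend (length-polyMul (a′ ∷ p) q (s≤s z≤n) hq)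
  where
  W = polyMul (a′ ∷ p) q
  extend : suc (length W) ≡ length (a′ ∷ p) + length q →
           suc (length (polyAdd (scale a q) (0 ∷ W))) ≡ length (a ∷ a′ ∷ p) + length q
  extend ih = cong suc (trans (length-polyAdd (scale a q) (0 ∷ W) shorter) ih)
    where
    shorter : length (scale a q) ≤ suc (length W)
    shorter = subst₂ _≤_ (sym (length-scale a q)) (sym ih) (m≤n+m (length q) (length (a′ ∷ p)))

polyMul-snoc : ∀ s a q → 1 ≤ length q →
  polyMul (s ++ a ∷ []) q ≡ polyAdd (polyMul s q) (zeros (length s) ++ scale a q)
polyMul-snoc []      a q hq = polyMul-singleton a q hq
polyMul-snoc (c ∷ s) a q hq = begin
    polyAdd (scale c q) (0 ∷ polyMul (s ++ a ∷ []) q)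
  ≡⟨ cong (λ w → polyAdd (scale c q) (0 ∷ w)) (polyMul-snoc s a q hq) ⟩
    polyAdd (scale c q) (polyAdd (0 ∷ polyMul s q) (0 ∷ zeros (length s) ++ scale a q))
  ≡⟨ sym (polyAdd-assoc (scale c q) (0 ∷ polyMul s q) (0 ∷ zeros (length s) ++ scale a q)) ⟩
    polyAdd (polyMul (c ∷ s) q) (zeros (length (c ∷ s)) ++ scale a q)
  ∎
  where open ≡-Reasoning

reverse-polyMul-nonempty : ∀ p q → 1 ≤ length p → 1 ≤ length q →
  reverse (polyMul p q) ≡ polyMul (reverse p) (reverse q)
reverse-polyMul-nonempty (a ∷ []) q _ hq = begin
    reverse (polyMul (a ∷ []) q)  ≡⟨ cong reverse (polyMul-singleton a q hq) ⟩
    reverse (scale a q)           ≡⟨ reverse-scale a q ⟩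
    scale a (reverse q)           ≡⟨ sym (polyMul-singleton a (reverse q) hq′) ⟩
    polyMul (a ∷ []) (reverse q)  ∎
  where
  open ≡-Reasoning
  hq′ : 1 ≤ length (reverse q)
  hq′ = subst (1 ≤_) (sym (length-reverse q)) hq
reverse-polyMul-nonempty (a ∷ a′ ∷ p) q _ hq = begin
    reverse (polyAdd (scale a q) (0 ∷ W))
  ≡⟨ reverse-polyAdd-shorter (scale a q) k (0 ∷ W) scaled-length ⟩
    polyAdd (zeros k ++ reverse (scale a q)) (reverse (0 ∷ W))
  ≡⟨ cong₂ polyAdd (cong (zeros k ++_) (reverse-scale a q)) (unfold-reverse 0 W) ⟩
    polyAdd (zeros k ++ scale a Q′) (reverse W ++ zeros 1)
  ≡⟨ polyAdd-comm (zeros k ++ scale a Q′) (reverse W ++ zeros 1) ⟩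
    polyAdd (reverse W ++ zeros 1) (zeros k ++ scale a Q′)
  ≡⟨ polyAdd-zerosʳ (reverse W) 1 (zeros k ++ scale a Q′) (≤-reflexive shifted-length) ⟩
    polyAdd (reverse W) (zeros k ++ scale a Q′)
  ≡⟨ cong (λ w → polyAdd w (zeros k ++ scale a Q′)) (reverse-polyMul-nonempty (a′ ∷ p) q (s≤s z≤n) hq) ⟩
    polyAdd (polyMul P′ Q′) (zeros k ++ scale a Q′)
  ≡⟨ sym (polyMul-snoc P′ a Q′ (subst (1 ≤_) (sym (length-reverse q)) hq)) ⟩
    polyMul (P′ ++ a ∷ []) Q′
  ≡⟨ cong (λ x → polyMul x Q′) (sym (unfold-reverse a (a′ ∷ p))) ⟩
    polyMul (reverse (a ∷ a′ ∷ p)) Q′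
  ∎
  where
  open ≡-Reasoning
  W  = polyMul (a′ ∷ p) q
  P′ = reverse (a′ ∷ p)
  Q′ = reverse q
  k  = length P′
  lW : suc (length W) ≡ k + length q
  lW = trans (length-polyMul (a′ ∷ p) q (s≤s z≤n) hq) (cong (_+ length q) (sym (length-reverse (a′ ∷ p))))
  scaled-length : length (scale a q) + k ≡ length (0 ∷ W)
  scaled-length = trans (cong (_+ k) (length-scale a q)) (trans (+-comm (length q) k) (sym lW))
  shifted-length : length (reverse W) + 1 ≡ length (zeros k ++ scale a Q′)
  shifted-length = begin
      length (reverse W) + 1          ≡⟨ cong (_+ 1) (length-reverse W) ⟩
      length W + 1                    ≡⟨ +-comm (length W) 1 ⟩
      suc (length W)                  ≡⟨ lW ⟩
      k + length q                    ≡⟨ cong (k +_) (sym (trans (length-scale a Q′) (length-reverse q))) ⟩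
      k + length (scale a Q′)         ≡⟨ sym (length-zeros-++ k (scale a Q′)) ⟩
      length (zeros k ++ scale a Q′)  ∎

reverse-polyMul : ∀ p q → reverse (polyMul p q) ≡ polyMul (reverse p) (reverse q)
reverse-polyMul []      q       = refl
reverse-polyMul (a ∷ p) []      = begin
    reverse (polyMul (a ∷ p) [])      ≡⟨ cong reverse (polyMul-[]ʳ (a ∷ p)) ⟩
    reverse (zeros (length (a ∷ p)))  ≡⟨ reverse-zeros (length (a ∷ p)) ⟩
    zeros (length (a ∷ p))            ≡⟨ cong zeros (sym (length-reverse (a ∷ p))) ⟩
    zeros (length (reverse (a ∷ p)))  ≡⟨ sym (polyMul-[]ʳ (reverse (a ∷ p))) ⟩
    polyMul (reverse (a ∷ p)) []      ∎
  where open ≡-Reasoning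
reverse-polyMul (a ∷ p) (b ∷ q) = reverse-polyMul-nonempty (a ∷ p) (b ∷ q) (s≤s z≤n) (s≤s z≤n)


nonempty-zeros-++ : ∀ z e → 1 ≤ length e → 1 ≤ length (zeros z ++ e)
nonempty-zeros-++ zero    e h = h
nonempty-zeros-++ (suc z) e h = s≤s z≤n

polyMul-0∷ˡ : ∀ p q → 1 ≤ length p → 1 ≤ length q → polyMul (0 ∷ p) q ≡ 0 ∷ polyMul p q
polyMul-0∷ˡ p q hp hq =
  trans (cong (λ x → polyAdd x (0 ∷ polyMul p q)) (scale-zero q))
        (polyAdd-zerosʳ [] (length q) (0 ∷ polyMul p q) fits)
  where
  fits : length q ≤ suc (length (polyMul p q))
  fits = subst (length q ≤_) (sym (length-polyMul p q hp hq)) (m≤n+m (length q) (length p))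

polyMul-0∷ʳ : ∀ p q → 1 ≤ length p → 1 ≤ length q → polyMul p (0 ∷ q) ≡ 0 ∷ polyMul p q
polyMul-0∷ʳ (a ∷ [])     q _ hq =
  trans (polyMul-singleton a (0 ∷ q) (s≤s z≤n)) (cong₂ _∷_ (*-zeroʳ a) (sym (polyMul-singleton a q hq)))
polyMul-0∷ʳ (a ∷ a′ ∷ p) q _ hq =
  trans (cong (λ w → polyAdd ((a * 0) ∷ scale a q) (0 ∷ w)) (polyMul-0∷ʳ (a′ ∷ p) q (s≤s z≤n) hq))
        (cong (_∷ polyAdd (scale a q) (0 ∷ polyMul (a′ ∷ p) q)) (trans (+-identityʳ (a * 0)) (*-zeroʳ a)))

polyMul-shift : ∀ y z p q → 1 ≤ length p → 1 ≤ length q →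
  polyMul (zeros y ++ p) (zeros z ++ q) ≡ zeros y ++ zeros z ++ polyMul p q
polyMul-shift (suc y) z p q hp hq =
  trans (polyMul-0∷ˡ (zeros y ++ p) (zeros z ++ q) (nonempty-zeros-++ y p hp) (nonempty-zeros-++ z q hq))
        (cong (0 ∷_) (polyMul-shift y z p q hp hq))
polyMul-shift zero (suc z) p q hp hq =
  trans (polyMul-0∷ʳ p (zeros z ++ q) hp (nonempty-zeros-++ z q hq))
        (cong (0 ∷_) (polyMul-shift zero z p q hp hq))
polyMul-shift zero zero p q hp hq = refl


module _ where
  open +-*-Solver

  fromDigits-polyAdd : ∀ p q → fromDigits (polyAdd p q) ≡ fromDigits p + fromDigits q
  fromDigits-polyAdd []      q       = refl
  fromDigits-polyAdd (a ∷ p) []      = sym (+-identityʳ _)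
  fromDigits-polyAdd (a ∷ p) (b ∷ q) rewrite fromDigits-polyAdd p q =
    solve 4 (λ a b x y → (a :+ b) :+ con 10 :* (x :+ y) := (a :+ con 10 :* x) :+ (b :+ con 10 :* y))
      refl a b (fromDigits p) (fromDigits q)

  fromDigits-scale : ∀ c p → fromDigits (scale c p) ≡ c * fromDigits p
  fromDigits-scale c []      = sym (*-zeroʳ c)
  fromDigits-scale c (a ∷ p) rewrite fromDigits-scale c p =
    solve 3 (λ c a x → c :* a :+ con 10 :* (c :* x) := c :* (a :+ con 10 :* x)) refl c a (fromDigits p)

  fromDigits-polyMul : ∀ p q → fromDigits (polyMul p q) ≡ fromDigits p * fromDigits q
  fromDigits-polyMul []      q = refl
  fromDigits-polyMul (a ∷ p) q
    rewrite fromDigits-polyAdd (scale a q) (0 ∷ polyMul p q) | fromDigits-scale a q | fromDigits-polyMul p q =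
    solve 3 (λ a x y → a :* y :+ con 10 :* (x :* y) := (a :+ con 10 :* x) :* y) refl a (fromDigits p) (fromDigits q)

fromDigits-++-zeros : ∀ L k → fromDigits (L ++ zeros k) ≡ fromDigits L
fromDigits-++-zeros []      zero    = refl
fromDigits-++-zeros []      (suc k) = cong (10 *_) (fromDigits-++-zeros [] k)
fromDigits-++-zeros (a ∷ L) k       = cong (λ x → a + 10 * x) (fromDigits-++-zeros L k)


digitsAux-step : ∀ f n → 0 < n → digitsAux (suc f) n ≡ n % 10 ∷ digitsAux f (n / 10)
digitsAux-step f (suc n) _ = refl

/10-fuel : ∀ n f → 0 < n → n ≤ suc f → n / 10 ≤ f
/10-fuel (suc n) f _ n≤ = ≤-pred (<-≤-trans (m/n<m (suc n) 10 (s≤s (s≤s z≤n))) n≤)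

fromDigits-digitsAux : ∀ f n → n ≤ f → fromDigits (digitsAux f n) ≡ n
fromDigits-digitsAux zero    zero    _  = refl
fromDigits-digitsAux (suc f) zero    _  = refl
fromDigits-digitsAux (suc f) (suc n) n≤ = begin
    suc n % 10 + 10 * fromDigits (digitsAux f (suc n / 10))
  ≡⟨ cong (λ x → suc n % 10 + 10 * x) (fromDigits-digitsAux f (suc n / 10) (/10-fuel (suc n) f (s≤s z≤n) n≤)) ⟩
    suc n % 10 + 10 * (suc n / 10)
  ≡⟨ cong (suc n % 10 +_) (*-comm 10 (suc n / 10)) ⟩
    suc n % 10 + suc n / 10 * 10
  ≡⟨ sym (m≡m%n+[m/n]*n (suc n) 10) ⟩
    suc n
  ∎
  where open ≡-Reasoning

fromDigits-digits : ∀ n → fromDigits (digits n) ≡ n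
fromDigits-digits n = fromDigits-digitsAux n n ≤-refl

digits-<10 : ∀ n → All (_< 10) (digits n)
digits-<10 n = go n n
  where
  go : ∀ f n → All (_< 10) (digitsAux f n)
  go zero    n       = []
  go (suc f) zero    = []
  go (suc f) (suc n) = m%n<n (suc n) 10 ∷ go f (suc n / 10)

LastNonZero : List ℕ → Set
LastNonZero []          = ⊤
LastNonZero (a ∷ [])    = a ≢ 0
LastNonZero (a ∷ b ∷ L) = LastNonZero (b ∷ L)

LastNonZero-snoc : ∀ xs c → c ≢ 0 → LastNonZero (xs ++ c ∷ [])
LastNonZero-snoc []           c c≢0 = c≢0
LastNonZero-snoc (x ∷ [])     c c≢0 = c≢0
LastNonZero-snoc (x ∷ y ∷ xs) c c≢0 = LastNonZero-snoc (y ∷ xs) c c≢0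

LastNonZero-tail : ∀ a L → LastNonZero (a ∷ L) → LastNonZero L
LastNonZero-tail a []      _ = _
LastNonZero-tail a (b ∷ L) h = h

fromDigits-pos : ∀ a L → LastNonZero (a ∷ L) → 0 < fromDigits (a ∷ L)
fromDigits-pos zero    []      a≢0 = contradiction refl a≢0
fromDigits-pos (suc a) []      _   = s≤s z≤n
fromDigits-pos a       (b ∷ L) h   =
  ≤-trans (fromDigits-pos b L h) (≤-trans (m≤n*m (fromDigits (b ∷ L)) 10) (m≤n+m _ a))

[d+10m]%10≡d : ∀ d m → d < 10 → (d + 10 * m) % 10 ≡ d
[d+10m]%10≡d d m d<10 =
  trans (cong (λ x → (d + x) % 10) (*-comm 10 m)) (trans ([m+kn]%n≡m%n d m 10) (m<n⇒m%n≡m d<10))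

[d+10m]/10≡m : ∀ d m → d < 10 → (d + 10 * m) / 10 ≡ m
[d+10m]/10≡m d m d<10 = begin
    (d + 10 * m) / 10     ≡⟨ cong (λ x → (d + x) / 10) (*-comm 10 m) ⟩
    (d + m * 10) / 10     ≡⟨ +-distrib-/-∣ʳ d (n∣m*n m) ⟩
    d / 10 + m * 10 / 10  ≡⟨ cong₂ _+_ (m<n⇒m/n≡0 d<10) (m*n/n≡m m 10) ⟩
    m                     ∎
  where open ≡-Reasoning

digitsAux-fromDigits : ∀ L → All (_< 10) L → LastNonZero L →
  ∀ f → fromDigits L ≤ f → digitsAux f (fromDigits L) ≡ L
digitsAux-fromDigits []      _            _  zero    _  = refl
digitsAux-fromDigits []      _            _  (suc f) _  = refl
digitsAux-fromDigits (a ∷ L) _            nz zero    n≤ =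
  contradiction (<-≤-trans (fromDigits-pos a L nz) n≤) n≮0
digitsAux-fromDigits (a ∷ L) (a<10 ∷ L<10) nz (suc f) n≤ = begin
    digitsAux (suc f) n                ≡⟨ digitsAux-step f n pos ⟩
    n % 10 ∷ digitsAux f (n / 10)      ≡⟨ cong₂ (λ x y → x ∷ digitsAux f y) ([d+10m]%10≡d a m a<10) high ⟩
    a ∷ digitsAux f m                  ≡⟨ cong (a ∷_) (digitsAux-fromDigits L L<10 (LastNonZero-tail a L nz) f m≤f) ⟩
    a ∷ L                              ∎
  where
  open ≡-Reasoning
  n = fromDigits (a ∷ L)
  m = fromDigits L
  pos : 0 < n
  pos = fromDigits-pos a L nz
  high : n / 10 ≡ m
  high = [d+10m]/10≡m a m a<10
  m≤f : m ≤ f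
  m≤f = subst (_≤ f) high (/10-fuel n f pos n≤)

digits-fromDigits : ∀ L → All (_< 10) L → LastNonZero L → digits (fromDigits L) ≡ L
digits-fromDigits L L<10 nz = digitsAux-fromDigits L L<10 nz (fromDigits L) ≤-refl

digits-fromDigits-reverse : ∀ h t → h ≢ 0 → All (_< 10) (h ∷ t) →
  digits (fromDigits (reverse (h ∷ t))) ≡ reverse (h ∷ t)
digits-fromDigits-reverse h t h≢0 ht<10 =
  digits-fromDigits (reverse (h ∷ t)) (All-reverse (h ∷ t) ht<10)
    (subst LastNonZero (sym (unfold-reverse h t)) (LastNonZero-snoc (reverse t) h h≢0))


split-trailing-zeros : ∀ A → A > 0 →
  ∃[ z ] ∃[ h ] ∃[ t ] (h ≢ 0 × digits A ≡ zeros z ++ h ∷ t)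
split-trailing-zeros A A>0 = split (digits A) (subst (0 <_) (sym (fromDigits-digits A)) A>0)
  where
  split : ∀ d → 0 < fromDigits d → ∃[ z ] ∃[ h ] ∃[ t ] (h ≢ 0 × d ≡ zeros z ++ h ∷ t)
  split (zero ∷ d) pos with split d (*-cancelˡ-< 10 0 (fromDigits d) pos)
  ... | z , h , t , h≢0 , eq = suc z , h , t , h≢0 , cong (0 ∷_) eq
  split (suc h ∷ d) _ = 0 , suc h , d , (λ ()) , refl

rev-trailing-zeros : ∀ A z e → digits A ≡ zeros z ++ e → rev A ≡ fromDigits (reverse e)
rev-trailing-zeros A z e eq = begin
    fromDigits (reverse (digits A))            ≡⟨ cong (λ x → fromDigits (reverse x)) eq ⟩
    fromDigits (reverse (zeros z ++ e))        ≡⟨ cong fromDigits (reverse-++ (zeros z) e) ⟩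
    fromDigits (reverse e ++ reverse (zeros z)) ≡⟨ cong (λ x → fromDigits (reverse e ++ x)) (reverse-zeros z) ⟩
    fromDigits (reverse e ++ zeros z)          ≡⟨ fromDigits-++-zeros (reverse e) z ⟩
    fromDigits (reverse e)                     ∎
  where open ≡-Reasoning

digits-rev : ∀ A z h t → h ≢ 0 → digits A ≡ zeros z ++ h ∷ t → digits (rev A) ≡ reverse (h ∷ t)
digits-rev A z h t h≢0 eq =
  trans (cong digits (rev-trailing-zeros A z (h ∷ t) eq))
        (digits-fromDigits-reverse h t h≢0 (++⁻ʳ (zeros z) (subst (All (_< 10)) eq (digits-<10 A))))

leading-product : ∀ a b → a ≢ 0 → b ≢ 0 → a * b + 0 ≢ 0
leading-product zero    b       a≢0 _   = contradiction refl a≢0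
leading-product (suc a) zero    _   b≢0 = contradiction refl b≢0
leading-product (suc a) (suc b) _   _   ()


rev-multiplicative : ∀ A B → PolyPair A B → rev (A * B) ≡ rev A * rev B
rev-multiplicative A B pair = begin
    fromDigits (reverse (digits (A * B)))
  ≡⟨ cong (λ x → fromDigits (reverse x)) (sym pair) ⟩
    fromDigits (reverse (polyMul (digits A) (digits B)))
  ≡⟨ cong fromDigits (reverse-polyMul (digits A) (digits B)) ⟩
    fromDigits (polyMul (reverse (digits A)) (reverse (digits B)))
  ≡⟨ fromDigits-polyMul (reverse (digits A)) (reverse (digits B)) ⟩
    rev A * rev B
  ∎
  where open ≡-Reasoning

rev-polyPair : ∀ A B → A > 0 → B > 0 → PolyPair A B → PolyPair (rev A) (rev B)
rev-polyPair A B A>0 B>0 pair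
  with split-trailing-zeros A A>0 | split-trailing-zeros B B>0
... | zA , hA , tA , hA≢0 , dA | zB , hB , tB , hB≢0 , dB = begin
    polyMul (digits (rev A)) (digits (rev B))
  ≡⟨ cong₂ polyMul (digits-rev A zA hA tA hA≢0 dA) (digits-rev B zB hB tB hB≢0 dB) ⟩
    polyMul (reverse eA) (reverse eB)
  ≡⟨ sym (reverse-polyMul eA eB) ⟩
    reverse (polyMul eA eB)
  ≡⟨ sym (digits-fromDigits-reverse (hA * hB + 0) _ (leading-product hA hB hA≢0 hB≢0) product-digits) ⟩
    digits (fromDigits (reverse (polyMul eA eB)))
  ≡⟨ cong digits value ⟩
    digits (rev A * rev B)
  ∎
  where
  open ≡-Reasoning
  eA = hA ∷ tA
  eB = hB ∷ tB
  -- P(A)P(B) = x^(zA+zB) eA eB, and its coefficients are the digits of AB.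
  product-digits : All (_< 10) (polyMul eA eB)
  product-digits = ++⁻ʳ (zeros zB) (++⁻ʳ (zeros zA) (subst (All (_< 10))
    (trans (sym pair) (trans (cong₂ polyMul dA dB) (polyMul-shift zA zB eA eB (s≤s z≤n) (s≤s z≤n))))
    (digits-<10 (A * B))))
  value : fromDigits (reverse (polyMul eA eB)) ≡ rev A * rev B
  value = begin
      fromDigits (reverse (polyMul eA eB))
    ≡⟨ cong fromDigits (reverse-polyMul eA eB) ⟩
      fromDigits (polyMul (reverse eA) (reverse eB))
    ≡⟨ fromDigits-polyMul (reverse eA) (reverse eB) ⟩
      fromDigits (reverse eA) * fromDigits (reverse eB)
    ≡⟨ sym (cong₂ _*_ (rev-trailing-zeros A zA eA dA) (rev-trailing-zeros B zB eB dB)) ⟩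
      rev A * rev B
    ∎

proposition16 : (A : ℕ) → A > 0 → PolyPair A A →
    PolyPair (rev A) (rev A) × rev (A * A) ≡ rev A * rev A
proposition16 A A>0 pair = rev-polyPair A A A>0 A>0 pair , rev-multiplicative A A pair
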